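{- For every $n\ge1$, $|\mathrm{Sort}_n(\mathfrak{s}_{1\underline{23}})|=2^n-n$.
   Context: A pattern is a permutation $\sigma$ in which some blocks of consecutive entries may be underlined; a sequence contains it if it has a subsequence order-isomorphic to $\sigma$ whose entries corresponding to a common underlined block are adjacent in the sequence. Pattern-avoiding stack map $\mathfrak{s}_\sigma$: process input $\tau_1,\dots,\tau_n$ in order; when $\tau_i$ is next, while the stack is nonempty and the sequence formed by placing $\tau_i$ on top of the stack, read top to bottom, contains $\sigma$ (underlined entries adjacent in the stack), pop the top entry to the output; then push $\tau_i$; at the end pop all remaining entries top to bottom to the output. West's stack-sorting map $s$ pushes each input entry after popping all smaller stack entries to the output, emptying the stack at the end. $\mathrm{Sort}_n(\mathfrak{s}_\sigma)=\{\tau\in\mathfrak S_n: s(\mathfrak{s}_\sigma(\tau))=12\cdots n\}$. -}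

module Defs where

open import Data.Nat using (ℕ; zero; suc; _<ᵇ_)
open import Data.Nat.Properties using (_≟_)
open import Data.Bool using (Bool; true; false; _∧_; _∨_; if_then_else_)
open import Data.List using (List; []; _∷_; _++_; [_]; map; concatMap; upTo; length; filter)
open import Data.List.Properties using (≡-dec)
open import Data.Product using (_×_; _,_)

-- All permutations of [1..n] (as lists in one-line notation), each exactly once:
-- obtained by inserting n into every position of every permutation of [1..n-1].
insertions : ℕ → List ℕ → List (List ℕ)
insertions x []       = [ x ∷ [] ]
insertions x (y ∷ ys) = (x ∷ y ∷ ys) ∷ map (y ∷_) (insertions x ys)

perms : ℕ → List (List ℕ)
perms zero    = [] ∷ []
perms (suc n) = concatMap (insertions (suc n)) (perms n)

idPerm : ℕ → List ℕ
idPerm n = map suc (upTo n)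

adjPairAbove : ℕ → List ℕ → Bool
adjPairAbove x []           = false
adjPairAbove x (y ∷ [])     = false
adjPairAbove x (y ∷ z ∷ zs) = ((x <ᵇ y) ∧ (y <ᵇ z)) ∨ adjPairAbove x (z ∷ zs)

-- Does the sequence contain the pattern 1 \underline{23}: positions a < b, c = b+1,
-- with s_a < s_b < s_c (entries s_b, s_c adjacent).
contains1-23 : List ℕ → Bool
contains1-23 []       = false
contains1-23 (x ∷ xs) = adjPairAbove x xs ∨ contains1-23 xs

-- Stacks are lists with the head being the top of the stack.
popWhile : ℕ → List ℕ → List ℕ → List ℕ × List ℕ
popWhile x []       out = [] , out
popWhile x (t ∷ st) out =
  if contains1-23 (x ∷ t ∷ st) then popWhile x st (out ++ [ t ]) else (t ∷ st , out)

stackMapGo : List ℕ → List ℕ → List ℕ → List ℕ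
stackMapGo []       stack out = out ++ stack
stackMapGo (x ∷ xs) stack out with popWhile x stack out
... | (stack' , out') = stackMapGo xs (x ∷ stack') out'

stackMap1-23 : List ℕ → List ℕ
stackMap1-23 τ = stackMapGo τ [] []

popSmaller : ℕ → List ℕ → List ℕ → List ℕ × List ℕ
popSmaller x []       out = [] , out
popSmaller x (t ∷ st) out =
  if t <ᵇ x then popSmaller x st (out ++ [ t ]) else (t ∷ st , out)

westGo : List ℕ → List ℕ → List ℕ → List ℕ
westGo []       stack out = out ++ stack
westGo (x ∷ xs) stack out with popSmaller x stack out
... | (stack' , out') = westGo xs (x ∷ stack') out'

westSort : List ℕ → List ℕ
westSort τ = westGo τ [] []

Sort1-23 : ℕ → List (List ℕ)
Sort1-23 n = filter (λ τ → ≡-dec _≟_ (westSort (stackMap1-23 τ)) (idPerm n)) (perms n)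

-- Reading τ, the stack of 𝔰_{1\underline{23}} is one decreasing run while τ increases, and
-- afterwards an upper decreasing run on a lower one, above a decreasing output; an automaton
-- recording a few extreme entries follows this.  If it accepts τ, the final word 𝔰(τ) splits
-- into decreasing blocks H L U with L < U < H, which West's map sorts.  If it rejects, output
-- followed by stack already contains a 231, which survives in 𝔰(τ), and s never sorts a 231.
-- So Sort_n is the language of the automaton.  An accepted τ is either the identity (I), or has a
-- descent and stays accepted behind a new maximum (P), or not (N).  Inserting n + 1 at every
-- position of every τ ∈ 𝔖_n gives I′ = I, P′ = I + 2P, N′ = P + N, so I_n = 1,
-- P_n = 2^(n-1) - 1, N_n = 2^(n-1) - n, and |Sort_n| = 2^n - n.

module Submission where

open import Defs
open import Data.Nat
open import Data.Nat.Properties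
open import Data.Nat.Solver using (module +-*-Solver)
open import Data.Bool using (Bool; true; false; _∧_; not; if_then_else_; T)
open import Data.Bool.Properties using (∧-zeroʳ; ∧-identityʳ; ∨-identityʳ)
open import Data.Maybe using (Maybe; just; nothing; is-just)
open import Data.List using (List; []; _∷_; _++_; [_]; map; concatMap; length; upTo; reverse; filter; last)
open import Data.List.Properties using (map-++; upTo-∷ʳ; ++-assoc; ++-identityʳ; reverse-++; unfold-reverse; ≡-dec)
open import Data.List.Relation.Unary.All as All using (All; []; _∷_)
import Data.List.Relation.Unary.All.Properties as All
open import Data.List.Relation.Unary.AllPairs as AllPairs using (AllPairs; []; _∷_)
import Data.List.Relation.Unary.AllPairs.Properties as AllPairsₚ
open import Data.List.Relation.Unary.Any using (here; there)
open import Data.List.Relation.Unary.Linked using (Linked)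
open import Data.List.Relation.Unary.Linked.Properties using (AllPairs⇒Linked)
open import Data.List.Relation.Unary.Sorted.TotalOrder.Properties using (↗↭↗⇒≋)
open import Data.List.Relation.Binary.Equality.Propositional using (≋⇒≡)
open import Data.List.Relation.Unary.Unique.Propositional using (Unique)
open import Data.List.Membership.Propositional using (_∈_)
open import Data.List.Membership.Propositional.Properties using (∈-++⁺ˡ; ∈-++⁺ʳ; ∈-++⁻)
open import Data.List.Relation.Binary.Sublist.Propositional using (_⊆_; []; _∷_; _∷ʳ_; ⊆-refl; ⊆-trans; from∈; to∈)
import Data.List.Relation.Binary.Sublist.Propositional.Properties as Sublist
open import Data.List.Relation.Binary.Permutation.Propositional using (_↭_; ↭-refl; ↭-sym; ↭-trans; ↭-reflexive; prep; ↭-swap; ↭⇒↭ₛ; module PermutationReasoning)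
open import Data.List.Relation.Binary.Permutation.Propositional.Properties using (All-resp-↭; ∷↭∷ʳ; ↭-length; shift; ∈-resp-↭; ↭-reverse)
import Data.List.Relation.Binary.Permutation.Setoid.Properties as Perm
open import Data.Unit using (⊤; tt)
open import Data.Empty using (⊥; ⊥-elim)
open import Data.Product using (_×_; _,_; proj₁; proj₂; Σ)
open import Data.Sum using (_⊎_; inj₁; inj₂)
open import Function using (flip)
open import Relation.Nullary using (Dec; yes; no; does)
open import Relation.Binary.Definitions using (tri<; tri≈; tri>)
open import Relation.Binary.PropositionalEquality hiding ([_])

<ᵇ-true⇒< : ∀ {m n} → (m <ᵇ n) ≡ true → m < n
<ᵇ-true⇒< {m} {n} eq = <ᵇ⇒< m n (subst T (sym eq) tt)

<ᵇ-false⇒≥ : ∀ {m n} → (m <ᵇ n) ≡ false → n ≤ m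
<ᵇ-false⇒≥ eq = ≮⇒≥ (λ m<n → subst T eq (<⇒<ᵇ m<n))

<⇒<ᵇ-true : ∀ {m n} → m < n → (m <ᵇ n) ≡ true
<⇒<ᵇ-true {m} {n} m<n with m <ᵇ n | <⇒<ᵇ m<n
... | true | _ = refl

≥⇒<ᵇ-false : ∀ {m n} → n ≤ m → (m <ᵇ n) ≡ false
≥⇒<ᵇ-false {m} {n} n≤m with m <ᵇ n in eq
... | false = refl
... | true = ⊥-elim (<⇒≱ (<ᵇ-true⇒< eq) n≤m)

∧-true⁻ : ∀ {a b} → (a ∧ b) ≡ true → (a ≡ true) × (b ≡ true)
∧-true⁻ {true} {true} _ = refl , refl

Bool-ext : ∀ {a b : Bool} → (a ≡ true → b ≡ true) → (b ≡ true → a ≡ true) → a ≡ b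
Bool-ext {false} {false} _ _ = refl
Bool-ext {false} {true}  _ g = g refl
Bool-ext {true}  {false} f _ = sym (f refl)
Bool-ext {true}  {true}  _ _ = refl

Increasing Decreasing : List ℕ → Set
Increasing = AllPairs _<_
Decreasing = AllPairs _>_

Unique-resp-↭ : ∀ {xs ys : List ℕ} → xs ↭ ys → Unique xs → Unique ys
Unique-resp-↭ p = Perm.Unique-resp-↭ (setoid ℕ) (↭⇒↭ₛ p)

Unique-∉-prefix : ∀ (xs : List ℕ) x ys → Unique (xs ++ x ∷ ys) → All (_≢ x) xs
Unique-∉-prefix []       x ys _           = []
Unique-∉-prefix (z ∷ xs) x ys (z∉ ∷ uniq) =
  All.lookup z∉ (∈-++⁺ʳ xs (here refl)) ∷ Unique-∉-prefix xs x ys uniq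

All-reverse⁺ : ∀ {P : ℕ → Set} {xs} → All P xs → All P (reverse xs)
All-reverse⁺ {xs = xs} = All-resp-↭ (↭-sym (↭-reverse xs))

AllPairs-++⁻ˡ : ∀ {R : ℕ → ℕ → Set} xs {ys} → AllPairs R (xs ++ ys) → AllPairs R xs
AllPairs-++⁻ˡ []       _          = []
AllPairs-++⁻ˡ (x ∷ xs) (rx ∷ rxs) = All.++⁻ˡ xs rx ∷ AllPairs-++⁻ˡ xs rxs

AllPairs-++⁻ʳ : ∀ {R : ℕ → ℕ → Set} xs {ys} → AllPairs R (xs ++ ys) → AllPairs R ys
AllPairs-++⁻ʳ []       rys       = rys
AllPairs-++⁻ʳ (x ∷ xs) (_ ∷ rxs) = AllPairs-++⁻ʳ xs rxs

AllPairs-∷ʳ⁺ : ∀ {R : ℕ → ℕ → Set} {xs y} → AllPairs R xs → All (flip R y) xs → AllPairs R (xs ++ [ y ])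
AllPairs-∷ʳ⁺ rxs rys = AllPairsₚ.++⁺ rxs ([] ∷ []) (All.map (_∷ []) rys)

AllPairs-reverse⁺ : ∀ {R : ℕ → ℕ → Set} {xs} → AllPairs R xs → AllPairs (flip R) (reverse xs)
AllPairs-reverse⁺ {xs = []}     []         = []
AllPairs-reverse⁺ {xs = x ∷ xs} (rx ∷ rxs) rewrite unfold-reverse x xs =
  AllPairs-∷ʳ⁺ (AllPairs-reverse⁺ rxs) (All-reverse⁺ rx)

AllPairs-⊆-pair : ∀ {R : ℕ → ℕ → Set} {a b xs} → AllPairs R xs → a ∷ b ∷ [] ⊆ xs → R a b
AllPairs-⊆-pair (ra ∷ _)   (refl ∷ b⊆) = All.lookup ra (to∈ b⊆)
AllPairs-⊆-pair (_ ∷ rxs)  (_ ∷ʳ ab⊆)  = AllPairs-⊆-pair rxs ab⊆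

AllPairs-⊆ : ∀ {R : ℕ → ℕ → Set} {xs ys} → xs ⊆ ys → AllPairs R ys → AllPairs R xs
AllPairs-⊆ []          []         = []
AllPairs-⊆ (refl ∷ xs⊆) (ry ∷ rys) = Sublist.All-resp-⊆ xs⊆ ry ∷ AllPairs-⊆ xs⊆ rys
AllPairs-⊆ (_ ∷ʳ xs⊆)   (_ ∷ rys)  = AllPairs-⊆ xs⊆ rys

AllPairs-++⁻-across : ∀ {R : ℕ → ℕ → Set} xs {ys} → AllPairs R (xs ++ ys) → All (λ x → All (R x) ys) xs
AllPairs-++⁻-across []       _          = []
AllPairs-++⁻-across (x ∷ xs) (rx ∷ rxs) = All.++⁻ʳ xs rx ∷ AllPairs-++⁻-across xs rxs

last-++-∷ : ∀ xs (y : ℕ) ys → last (xs ++ y ∷ ys) ≡ last (y ∷ ys)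
last-++-∷ []           y ys = refl
last-++-∷ (x ∷ [])     y ys = refl
last-++-∷ (x ∷ z ∷ xs) y ys = last-++-∷ (z ∷ xs) y ys

last≡nothing⇒[] : ∀ (xs : List ℕ) → last xs ≡ nothing → xs ≡ []
last≡nothing⇒[] []           _  = refl
last≡nothing⇒[] (x ∷ y ∷ xs) eq with () ← last≡nothing⇒[] (y ∷ xs) eq

last-∈ : ∀ (xs : List ℕ) {v} → last xs ≡ just v → v ∈ xs
last-∈ (x ∷ [])     refl = here refl
last-∈ (x ∷ y ∷ xs) eq   = there (last-∈ (y ∷ xs) eq)

Decreasing-last-≤ : ∀ xs {v} → Decreasing xs → last xs ≡ just v → All (v ≤_) xs
Decreasing-last-≤ (x ∷ [])     _            refl = ≤-refl ∷ []
Decreasing-last-≤ (x ∷ y ∷ xs) (x>ys ∷ dec) eq   with Decreasing-last-≤ (y ∷ xs) dec eq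
... | v≤y ∷ v≤xs = ≤-trans v≤y (<⇒≤ (All.lookup x>ys (here refl))) ∷ v≤y ∷ v≤xs

data DecreasingTo (e : ℕ) : List ℕ → Set where
  single : DecreasingTo e (e ∷ [])
  cons   : ∀ {d d′ D} → d′ < d → DecreasingTo e (d′ ∷ D) → DecreasingTo e (d ∷ d′ ∷ D)

DecreasingTo-≥ : ∀ {e D} → DecreasingTo e D → All (e ≤_) D
DecreasingTo-≥ single = ≤-refl ∷ []
DecreasingTo-≥ (cons d′<d dec) with DecreasingTo-≥ dec
... | e≤d′ ∷ e≤D = ≤-trans e≤d′ (<⇒≤ d′<d) ∷ e≤d′ ∷ e≤D

DecreasingTo-head-≥ : ∀ {e d D} → DecreasingTo e (d ∷ D) → e ≤ d
DecreasingTo-head-≥ dec = All.lookup (DecreasingTo-≥ dec) (here refl)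

DecreasingTo⇒Decreasing : ∀ {e D} → DecreasingTo e D → Decreasing D
DecreasingTo⇒Decreasing single = [] ∷ []
DecreasingTo⇒Decreasing (cons d′<d dec) with DecreasingTo⇒Decreasing dec
... | d′>D ∷ decD = (d′<d ∷ All.map (λ z<d′ → <-trans z<d′ d′<d) d′>D) ∷ d′>D ∷ decD

DecreasingTo-last : ∀ {e D} → DecreasingTo e D → last D ≡ just e
DecreasingTo-last single       = refl
DecreasingTo-last (cons _ dec) = DecreasingTo-last dec

DecreasingTo-∈ : ∀ {e D} → DecreasingTo e D → e ∈ D
DecreasingTo-∈ dec = last-∈ _ (DecreasingTo-last dec)

DecreasingTo-∈-tail : ∀ {e d D} → DecreasingTo e (d ∷ D) → d ≢ e → e ∈ D
DecreasingTo-∈-tail single       d≢e = ⊥-elim (d≢e refl)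
DecreasingTo-∈-tail (cons _ dec) _   = DecreasingTo-∈ dec

DecreasingTo-≤-head : ∀ {e d D} → DecreasingTo e (d ∷ D) → All (_≤ d) (d ∷ D)
DecreasingTo-≤-head dec with DecreasingTo⇒Decreasing dec
... | d>D ∷ _ = ≤-refl ∷ All.map <⇒≤ d>D

-- Permutations of 1 … n

Increasing-idPerm : ∀ n → Increasing (idPerm n)
Increasing-idPerm n = AllPairsₚ.map⁺ (AllPairsₚ.applyUpTo⁺₁ (λ i → i) n (λ i<j _ → s≤s i<j))

idPerm-< : ∀ n → All (_< suc n) (idPerm n)
idPerm-< n = All.map⁺ (All.applyUpTo⁺₁ (λ i → i) n s≤s)

Increasing-↭⇒≡ : ∀ {xs ys} → Increasing xs → Increasing ys → xs ↭ ys → xs ≡ ys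
Increasing-↭⇒≡ xs↗ ys↗ xs↭ys = ≋⇒≡ (↗↭↗⇒≋ ≤-totalOrder (sorted xs↗) (sorted ys↗) (↭⇒↭ₛ xs↭ys))
  where
  sorted : ∀ {zs} → Increasing zs → Linked _≤_ zs
  sorted zs↗ = AllPairs⇒Linked (AllPairs.map <⇒≤ zs↗)

Unique-↭-idPerm : ∀ n {τ} → τ ↭ idPerm n → Unique τ
Unique-↭-idPerm n τ↭ = Unique-resp-↭ (↭-sym τ↭) (AllPairs.map <⇒≢ (Increasing-idPerm n))

insertions-↭ : ∀ x σ → All (_↭ x ∷ σ) (insertions x σ)
insertions-↭ x []       = ↭-refl ∷ []
insertions-↭ x (y ∷ ys) =
  ↭-refl ∷ All.map⁺ (All.map (λ τ↭ → ↭-trans (prep y τ↭) (↭-swap y x ↭-refl)) (insertions-↭ x ys))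

idPerm-suc : ∀ n → idPerm (suc n) ≡ idPerm n ++ [ suc n ]
idPerm-suc n = trans (cong (map suc) (sym (upTo-∷ʳ n))) (map-++ suc (upTo n) [ n ])

perms-↭ : ∀ n → All (_↭ idPerm n) (perms n)
perms-↭ zero    = ↭-refl ∷ []
perms-↭ (suc n) = All.concat⁺ (All.map⁺ (All.map insert-max (perms-↭ n)))
  where
  insert-max : ∀ {σ} → σ ↭ idPerm n → All (_↭ idPerm (suc n)) (insertions (suc n) σ)
  insert-max σ↭ = All.map (λ τ↭ → ↭-trans τ↭ (↭-trans (prep (suc n) σ↭)
                    (↭-trans (∷↭∷ʳ (suc n) (idPerm n)) (↭-reflexive (sym (idPerm-suc n))))))
                    (insertions-↭ (suc n) _)

-- The stack map 𝔰_{1\underline{23}}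

adjPairAbove-decreasing : ∀ {e D} → DecreasingTo e D → ∀ x → adjPairAbove x D ≡ false
adjPairAbove-decreasing single x = refl
adjPairAbove-decreasing (cons {d} {d′} d′<d dec) x
  rewrite ≥⇒<ᵇ-false {d} {d′} (<⇒≤ d′<d) | ∧-zeroʳ (x <ᵇ d) = adjPairAbove-decreasing dec x

contains1-23-decreasing : ∀ {e D} → DecreasingTo e D → ∀ x → contains1-23 (x ∷ D) ≡ false
contains1-23-decreasing single x = refl
contains1-23-decreasing {D = D} (cons {d} d′<d dec) x
  rewrite adjPairAbove-decreasing (cons d′<d dec) x = contains1-23-decreasing dec d

-- Two stacked decreasing runs have a single ascent, at the junction e < h.
adjPairAbove-twoRuns : ∀ {e r₀ h D₁ D₂} → DecreasingTo e D₁ → DecreasingTo r₀ (h ∷ D₂) → e < r₀ →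
  ∀ x → adjPairAbove x (D₁ ++ h ∷ D₂) ≡ (x <ᵇ e)
adjPairAbove-twoRuns {e} {h = h} single dec₂ e<r₀ x
  rewrite <⇒<ᵇ-true {e} {h} (<-≤-trans e<r₀ (DecreasingTo-head-≥ dec₂))
        | ∧-identityʳ (x <ᵇ e) | adjPairAbove-decreasing dec₂ x = ∨-identityʳ (x <ᵇ e)
adjPairAbove-twoRuns (cons {d} {d′} d′<d dec₁) dec₂ e<r₀ x
  rewrite ≥⇒<ᵇ-false {d} {d′} (<⇒≤ d′<d) | ∧-zeroʳ (x <ᵇ d) = adjPairAbove-twoRuns dec₁ dec₂ e<r₀ x

contains1-23-twoRuns : ∀ {e r₀ h D₁ D₂} → DecreasingTo e D₁ → DecreasingTo r₀ (h ∷ D₂) → e < r₀ →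
  ∀ x → contains1-23 (x ∷ D₁ ++ h ∷ D₂) ≡ (x <ᵇ e)
contains1-23-twoRuns {e} single dec₂ e<r₀ x
  rewrite adjPairAbove-twoRuns single dec₂ e<r₀ x | contains1-23-decreasing dec₂ e = ∨-identityʳ (x <ᵇ e)
contains1-23-twoRuns {e} (cons {d} d′<d dec₁) dec₂ e<r₀ x
  rewrite adjPairAbove-twoRuns (cons d′<d dec₁) dec₂ e<r₀ x
        | contains1-23-twoRuns dec₁ dec₂ e<r₀ d
        | ≥⇒<ᵇ-false {d} {e} (<⇒≤ (≤-<-trans (DecreasingTo-head-≥ dec₁) d′<d)) = ∨-identityʳ (x <ᵇ e)

popWhile-stop : ∀ x st out → contains1-23 (x ∷ st) ≡ false → popWhile x st out ≡ (st , out)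
popWhile-stop x []       out _  = refl
popWhile-stop x (t ∷ st) out eq rewrite eq = refl

popWhile-upperRun : ∀ {e r₀ h D₁ D₂} → DecreasingTo e D₁ → DecreasingTo r₀ (h ∷ D₂) → e < r₀ →
  ∀ x out → x < e → popWhile x (D₁ ++ h ∷ D₂) out ≡ (h ∷ D₂ , out ++ D₁)
popWhile-upperRun {e} {h = h} {D₂ = D₂} single dec₂ e<r₀ x out x<e
  rewrite contains1-23-twoRuns single dec₂ e<r₀ x | <⇒<ᵇ-true x<e
        | popWhile-stop x (h ∷ D₂) (out ++ [ e ]) (contains1-23-decreasing dec₂ x) = refl
popWhile-upperRun {D₂ = D₂} (cons {d} {d′} {D} d′<d dec₁) dec₂ e<r₀ x out x<e
  rewrite contains1-23-twoRuns (cons d′<d dec₁) dec₂ e<r₀ x | <⇒<ᵇ-true x<e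
        | popWhile-upperRun dec₁ dec₂ e<r₀ x (out ++ [ d ]) x<e = cong (_ ,_) (++-assoc out [ d ] (d′ ∷ D))

Pops : List ℕ × List ℕ → List ℕ × List ℕ → Set
Pops (st , out) (st′ , out′) = Σ (List ℕ) λ P → (out′ ≡ out ++ P) × (P ++ st′ ≡ st)

Pops-++ : ∀ {st out st′ out′} → Pops (st , out) (st′ , out′) → out′ ++ st′ ≡ out ++ st
Pops-++ {out = out} (P , refl , refl) = ++-assoc out P _

Pops-push-↭ : ∀ {st out st′ out′} x xs → Pops (st , out) (st′ , out′) →
  out′ ++ (x ∷ st′) ++ xs ↭ out ++ st ++ x ∷ xs
Pops-push-↭ {st} {out} {st′} {out′} x xs pops = begin
  out′ ++ x ∷ st′ ++ xs    ↭⟨ shift x out′ (st′ ++ xs) ⟩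
  x ∷ out′ ++ st′ ++ xs    ≡⟨ cong (x ∷_) (sym (++-assoc out′ st′ xs)) ⟩
  x ∷ (out′ ++ st′) ++ xs  ≡⟨ cong (λ w → x ∷ w ++ xs) (Pops-++ pops) ⟩
  x ∷ (out ++ st) ++ xs    ↭⟨ shift x (out ++ st) xs ⟨
  (out ++ st) ++ x ∷ xs    ≡⟨ ++-assoc out st (x ∷ xs) ⟩
  out ++ st ++ x ∷ xs      ∎
  where open PermutationReasoning

popWhile-pops : ∀ x st out → Pops (st , out) (popWhile x st out)
popWhile-pops x []       out = [] , sym (++-identityʳ out) , refl
popWhile-pops x (t ∷ st) out with contains1-23 (x ∷ t ∷ st)
... | true with popWhile-pops x st (out ++ [ t ])
...   | P , out′≡ , st≡ = t ∷ P , trans out′≡ (++-assoc out [ t ] P) , cong (t ∷_) st≡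
popWhile-pops x (t ∷ st) out | false = [] , sym (++-identityʳ out) , refl

stackAfter outputAfter : ℕ → List ℕ → List ℕ → List ℕ
stackAfter  x st out = x ∷ proj₁ (popWhile x st out)
outputAfter x st out = proj₂ (popWhile x st out)

stackMapGo-↭ : ∀ xs st out → stackMapGo xs st out ↭ out ++ st ++ xs
stackMapGo-↭ []       st out rewrite ++-identityʳ st = ↭-refl
stackMapGo-↭ (x ∷ xs) st out =
  ↭-trans (stackMapGo-↭ xs (stackAfter x st out) (outputAfter x st out))
          (Pops-push-↭ x xs (popWhile-pops x st out))

stackMapGo-⊇ : ∀ xs st out → out ++ st ⊆ stackMapGo xs st out
stackMapGo-⊇ []       st out = ⊆-refl
stackMapGo-⊇ (x ∷ xs) st out =
  ⊆-trans (subst (_⊆ O ++ x ∷ S) (Pops-++ (popWhile-pops x st out)) (Sublist.++⁺ ⊆-refl (x ∷ʳ ⊆-refl)))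
          (stackMapGo-⊇ xs (stackAfter x st out) O)
  where
  O = outputAfter x st out
  S = proj₁ (popWhile x st out)

Unique-step : ∀ x st out xs → Unique (out ++ st ++ x ∷ xs) →
  Unique (outputAfter x st out ++ stackAfter x st out ++ xs)
Unique-step x st out xs = Unique-resp-↭ (↭-sym (Pops-push-↭ x xs (popWhile-pops x st out)))

Unique-fresh : ∀ x st out xs → Unique (out ++ st ++ x ∷ xs) → All (_≢ x) (out ++ st)
Unique-fresh x st out xs uniq =
  Unique-∉-prefix (out ++ st) x xs (subst Unique (sym (++-assoc out st (x ∷ xs))) uniq)

-- West's stack-sorting map

popSmaller-pops : ∀ x st out → Pops (st , out) (popSmaller x st out)
popSmaller-pops x []       out = [] , sym (++-identityʳ out) , refl
popSmaller-pops x (t ∷ st) out with t <ᵇ x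
... | true with popSmaller-pops x st (out ++ [ t ])
...   | P , out′≡ , st≡ = t ∷ P , trans out′≡ (++-assoc out [ t ] P) , cong (t ∷_) st≡
popSmaller-pops x (t ∷ st) out | false = [] , sym (++-identityʳ out) , refl

popSmaller-none : ∀ x st out → All (x <_) st → popSmaller x st out ≡ (st , out)
popSmaller-none x []       out _            = refl
popSmaller-none x (t ∷ st) out (x<t ∷ _) rewrite ≥⇒<ᵇ-false {t} {x} (<⇒≤ x<t) = refl

popSmaller-all : ∀ x P Q out → All (_< x) P → All (x <_) Q → popSmaller x (P ++ Q) out ≡ (Q , out ++ P)
popSmaller-all x []      Q out _           x<Q rewrite popSmaller-none x Q out x<Q | ++-identityʳ out = refl
popSmaller-all x (p ∷ P) Q out (p<x ∷ P<x) x<Q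
  rewrite <⇒<ᵇ-true p<x | popSmaller-all x P Q (out ++ [ p ]) P<x x<Q | ++-assoc out [ p ] P = refl

popSmaller-kept-≥ : ∀ x st out → AllPairs _≤_ st → All (x ≤_) (proj₁ (popSmaller x st out))
popSmaller-kept-≥ x []       out _                = []
popSmaller-kept-≥ x (t ∷ st) out (t≤st ∷ sorted) with t <ᵇ x in t<ᵇx
... | true  = popSmaller-kept-≥ x st (out ++ [ t ]) sorted
... | false = <ᵇ-false⇒≥ t<ᵇx ∷ All.map (≤-trans (<ᵇ-false⇒≥ t<ᵇx)) t≤st

westGo-↭ : ∀ xs st out → westGo xs st out ↭ out ++ st ++ xs
westGo-↭ []       st out rewrite ++-identityʳ st = ↭-refl
westGo-↭ (x ∷ xs) st out =
  ↭-trans (westGo-↭ xs (x ∷ proj₁ (popSmaller x st out)) (proj₂ (popSmaller x st out)))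
          (Pops-push-↭ x xs (popSmaller-pops x st out))

westGo-push-decreasing : ∀ D rest st out → Decreasing D → All (λ d → All (d <_) st) D →
  westGo (D ++ rest) st out ≡ westGo rest (reverse D ++ st) out
westGo-push-decreasing []      rest st out _            _              = refl
westGo-push-decreasing (x ∷ D) rest st out (x>D ∷ decD) (x<st ∷ D<st)
  rewrite popSmaller-none x st out x<st
        | westGo-push-decreasing D rest (x ∷ st) out decD (All.zipWith (λ (d<x , d<st) → d<x ∷ d<st) (x>D , D<st))
        | unfold-reverse x D | ++-assoc (reverse D) [ x ] st = refl

westGo-decreasing : ∀ D st out → Decreasing D → All (λ d → All (d <_) st) D →
  westGo D st out ≡ out ++ reverse D ++ st
westGo-decreasing D st out decD D<st = begin
  westGo D st out                 ≡⟨ cong (λ w → westGo w st out) (sym (++-identityʳ D)) ⟩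
  westGo (D ++ []) st out         ≡⟨ westGo-push-decreasing D [] st out decD D<st ⟩
  out ++ reverse D ++ st          ∎
  where open ≡-Reasoning

reverse-++₃ : ∀ (xs ys zs : List ℕ) → reverse (xs ++ ys ++ zs) ≡ reverse zs ++ reverse ys ++ reverse xs
reverse-++₃ xs ys zs
  rewrite reverse-++ xs (ys ++ zs) | reverse-++ ys zs = ++-assoc (reverse zs) (reverse ys) (reverse xs)

-- West's map sorts H L U when H U L is decreasing: H and L are pushed, the first entry of U
-- flushes L, and U is pushed on top of H.
westSort-blocks : ∀ H L u U → Decreasing (H ++ (u ∷ U) ++ L) →
  westSort (H ++ L ++ u ∷ U) ≡ reverse (H ++ (u ∷ U) ++ L)
westSort-blocks H L u U dec = begin
  westGo (H ++ L ++ u ∷ U) [] []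
    ≡⟨ cong (λ w → westGo w [] []) (sym (++-assoc H L (u ∷ U))) ⟩
  westGo ((H ++ L) ++ u ∷ U) [] []
    ≡⟨ westGo-push-decreasing (H ++ L) (u ∷ U) [] [] decHL (All.universal (λ _ → []) (H ++ L)) ⟩
  westGo (u ∷ U) (reverse (H ++ L) ++ []) []
    ≡⟨ cong (λ st → westGo (u ∷ U) st []) (trans (++-identityʳ _) (reverse-++ H L)) ⟩
  westGo (u ∷ U) (reverse L ++ reverse H) []
    ≡⟨ cong (λ p → westGo U (u ∷ proj₁ p) (proj₂ p))
            (popSmaller-all u (reverse L) (reverse H) [] (All-reverse⁺ L<u) (All-reverse⁺ u<H)) ⟩
  westGo U (u ∷ reverse H) (reverse L)
    ≡⟨ westGo-decreasing U (u ∷ reverse H) (reverse L) decU U<uH ⟩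
  reverse L ++ reverse U ++ u ∷ reverse H
    ≡⟨ cong (reverse L ++_) (trans (sym (++-assoc (reverse U) [ u ] (reverse H)))
                                   (cong (_++ reverse H) (sym (unfold-reverse u U)))) ⟩
  reverse L ++ reverse (u ∷ U) ++ reverse H
    ≡⟨ sym (reverse-++₃ H (u ∷ U) L) ⟩
  reverse (H ++ (u ∷ U) ++ L) ∎
  where
  open ≡-Reasoning
  decHL : Decreasing (H ++ L)
  decHL = AllPairs-⊆ (Sublist.++⁺ ⊆-refl (Sublist.++⁺ˡ (u ∷ U) ⊆-refl)) dec
  H>uUL : All (λ h → All (h >_) ((u ∷ U) ++ L)) H
  H>uUL = AllPairs-++⁻-across H dec
  uUL : Decreasing ((u ∷ U) ++ L)
  uUL = AllPairs-++⁻ʳ H dec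
  L<u : All (_< u) L
  L<u = All.++⁻ʳ U (AllPairs.head uUL)
  u<H : All (u <_) H
  u<H = All.map All.head H>uUL
  decU : Decreasing U
  decU = AllPairs-++⁻ˡ U (AllPairs.tail uUL)
  U<uH : All (λ d → All (d <_) (u ∷ reverse H)) U
  U<uH = All.zipWith (λ (d<u , d<H) → d<u ∷ All-reverse⁺ d<H)
           (All.++⁻ˡ U (AllPairs.head uUL) , All.All-swap (All.map (λ h>uUL → All.++⁻ˡ U (All.tail h>uUL)) H>uUL))

data Contains231 (w : List ℕ) : Set where
  occurrence : ∀ {b a c} → b < a → a < c → a ∷ c ∷ b ∷ [] ⊆ w → Contains231 w

data HasInversion (w : List ℕ) : Set where
  inversion : ∀ {b a} → b < a → a ∷ b ∷ [] ⊆ w → HasInversion w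

Contains231-⊆ : ∀ {w w′} → w ⊆ w′ → Contains231 w → Contains231 w′
Contains231-⊆ w⊆ (occurrence b<a a<c acb⊆) = occurrence b<a a<c (⊆-trans acb⊆ w⊆)

popSmaller-sorted : ∀ x st out → AllPairs _≤_ st → AllPairs _≤_ (x ∷ proj₁ (popSmaller x st out))
popSmaller-sorted x st out sorted with popSmaller-pops x st out
... | P , _ , P++S≡st =
  popSmaller-kept-≥ x st out sorted ∷ AllPairs-++⁻ʳ P (subst (AllPairs _≤_) (sym P++S≡st) sorted)

popSmaller-pops-smaller : ∀ x st out {a} → AllPairs _≤_ st → a ∈ st → a < x → a ∈ proj₂ (popSmaller x st out)
popSmaller-pops-smaller x st out {a} sorted a∈st a<x with popSmaller-pops x st out
... | P , out′≡ , P++S≡st with ∈-++⁻ P (subst (a ∈_) (sym P++S≡st) a∈st)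
...   | inj₁ a∈P = subst (a ∈_) (sym out′≡) (∈-++⁺ʳ out a∈P)
...   | inj₂ a∈S = ⊥-elim (<⇒≱ a<x (All.lookup (popSmaller-kept-≥ x st out sorted) a∈S))

popSmaller-output : ∀ x st out → popSmaller x st out ≡ (proj₁ (popSmaller x st []) , out ++ proj₂ (popSmaller x st []))
popSmaller-output x []       out = cong ([] ,_) (sym (++-identityʳ out))
popSmaller-output x (t ∷ st) out with t <ᵇ x
... | true  rewrite popSmaller-output x st (out ++ [ t ]) | popSmaller-output x st [ t ] =
                    cong (_ ,_) (++-assoc out [ t ] _)
... | false = cong (t ∷ st ,_) (sym (++-identityʳ out))

westGo-output : ∀ xs st out → westGo xs st out ≡ out ++ westGo xs st []
westGo-output []       st out = refl
westGo-output (x ∷ xs) st out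
  rewrite popSmaller-output x st out
        | westGo-output xs (x ∷ proj₁ (popSmaller x st [])) (out ++ proj₂ (popSmaller x st []))
        | westGo-output xs (x ∷ proj₁ (popSmaller x st [])) (proj₂ (popSmaller x st [])) =
  ++-assoc out _ _

westGo-output-before-input : ∀ xs st out {a b} → a ∈ out → b ∈ xs → a ∷ b ∷ [] ⊆ westGo xs st out
westGo-output-before-input xs st out a∈out b∈xs rewrite westGo-output xs st out =
  Sublist.++⁺ (from∈ a∈out) (from∈ (∈-resp-↭ (↭-sym (westGo-↭ xs st [])) (∈-++⁺ʳ st b∈xs)))

-- A stack entry a is output as soon as a larger entry c arrives, hence before everything after c.
westGo-stack-before : ∀ xs st out {a c b} → AllPairs _≤_ st → a ∈ st → c ∷ b ∷ [] ⊆ xs → a < c →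
  a ∷ b ∷ [] ⊆ westGo xs st out
westGo-stack-before (y ∷ ys) st out sorted a∈st (refl ∷ b⊆ys) a<c =
  westGo-output-before-input ys _ _ (popSmaller-pops-smaller y st out sorted a∈st a<c) (to∈ b⊆ys)
westGo-stack-before (y ∷ ys) st out {a} sorted a∈st (_ ∷ʳ cb⊆ys) a<c with popSmaller-pops y st out
... | P , out′≡ , P++S≡st with ∈-++⁻ P (subst (a ∈_) (sym P++S≡st) a∈st)
...   | inj₁ a∈P = westGo-output-before-input ys _ _ (subst (a ∈_) (sym out′≡) (∈-++⁺ʳ out a∈P))
                                                   (to∈ (Sublist.∷ˡ⁻ cb⊆ys))
...   | inj₂ a∈S = westGo-stack-before ys _ _ (popSmaller-sorted y st out sorted) (there a∈S) cb⊆ys a<c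

westGo-231 : ∀ xs st out {a c b} → AllPairs _≤_ st → a ∷ c ∷ b ∷ [] ⊆ xs → a < c →
  a ∷ b ∷ [] ⊆ westGo xs st out
westGo-231 (y ∷ ys) st out sorted (refl ∷ cb⊆ys) a<c =
  westGo-stack-before ys _ _ (popSmaller-sorted y st out sorted) (here refl) cb⊆ys a<c
westGo-231 (y ∷ ys) st out sorted (_ ∷ʳ acb⊆ys) a<c =
  westGo-231 ys _ _ (popSmaller-sorted y st out sorted) acb⊆ys a<c

westSort-231 : ∀ w → Contains231 w → HasInversion (westSort w)
westSort-231 w (occurrence b<a a<c acb⊆w) = inversion b<a (westGo-231 w [] [] [] acb⊆w a<c)

-- An automaton recognising Sort_n(𝔰_{1\underline{23}})

-- The automaton tracks just enough of the configuration of 𝔰_{1\underline{23}} (see Config).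
-- rising m M: the input so far increases from m to M and lies on the stack.
-- twoRuns r₀ r₁ e l o: the stack is an upper run l … e on a lower run r₁ … r₀ (both decreasing,
-- e < r₀), the output is decreasing with last entry o, and entries in (r₀ , r₁) are forbidden.
-- afterMax: after an entry exceeding all later ones; it leads to twoRuns with r₀ = r₁ = 0,
-- i.e. with nothing forbidden.
data State : Set where
  empty afterMax : State
  rising         : ℕ → ℕ → State
  twoRuns        : ℕ → ℕ → ℕ → ℕ → Maybe ℕ → State

outsideᵇ : ℕ → ℕ → ℕ → Bool
outsideᵇ r₀ r₁ x = not ((r₀ <ᵇ x) ∧ (x <ᵇ r₁))

belowᵇ : Maybe ℕ → ℕ → Bool
belowᵇ nothing  x = true
belowᵇ (just v) x = x <ᵇ v

stepTwoRuns : ℕ → ℕ → ℕ → ℕ → Maybe ℕ → ℕ → Maybe State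
stepTwoRuns r₀ r₁ e l o x =
  if outsideᵇ r₀ r₁ x
  then (if x <ᵇ e then just (twoRuns r₀ r₁ x x (just e))
        else (if (l <ᵇ x) ∧ belowᵇ o x then just (twoRuns r₀ r₁ e x o) else nothing))
  else nothing

stepRising : ℕ → ℕ → ℕ → Maybe State
stepRising m M x =
  if M <ᵇ x then just (rising m x) else (if x <ᵇ m then just (twoRuns m M x x nothing) else nothing)

step : State → ℕ → Maybe State
step empty                 x = just (rising x x)
step afterMax              x = just (twoRuns 0 0 x x nothing)
step (rising m M)          x = stepRising m M x
step (twoRuns r₀ r₁ e l o) x = stepTwoRuns r₀ r₁ e l o x

advance : Maybe State → ℕ → Maybe State
advance nothing  _ = nothing
advance (just s) x = step s x

run : Maybe State → List ℕ → Maybe State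
run nothing  _        = nothing
run (just s) []       = just s
run (just s) (x ∷ xs) = run (step s x) xs

accepts : State → List ℕ → Bool
accepts s ys = is-just (run (just s) ys)

run-∷ : ∀ ms y zs → run ms (y ∷ zs) ≡ run (advance ms y) zs
run-∷ nothing  y zs = refl
run-∷ (just s) y zs = refl

Outside : ℕ → ℕ → ℕ → Set
Outside r₀ r₁ z = (z < r₀) ⊎ (r₁ < z)

outsideᵇ-below : ∀ r₀ r₁ x → x < r₀ → outsideᵇ r₀ r₁ x ≡ true
outsideᵇ-below r₀ r₁ x x<r₀ rewrite ≥⇒<ᵇ-false {r₀} {x} (<⇒≤ x<r₀) = refl

outsideᵇ-empty : ∀ r x → outsideᵇ r r x ≡ true
outsideᵇ-empty r x with r <ᵇ x in r<ᵇx
... | false = refl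
... | true rewrite ≥⇒<ᵇ-false {x} {r} (<⇒≤ (<ᵇ-true⇒< r<ᵇx)) = refl

outsideᵇ⇒Outside : ∀ r₀ r₁ x → outsideᵇ r₀ r₁ x ≡ true → x ≢ r₀ → x ≢ r₁ → Outside r₀ r₁ x
outsideᵇ⇒Outside r₀ r₁ x out x≢r₀ x≢r₁ with r₀ <ᵇ x in r₀<ᵇx
... | false = inj₁ (≤∧≢⇒< (<ᵇ-false⇒≥ r₀<ᵇx) x≢r₀)
... | true with x <ᵇ r₁ in x<ᵇr₁
...   | false = inj₂ (≤∧≢⇒< (<ᵇ-false⇒≥ x<ᵇr₁) (λ eq → x≢r₁ (sym eq)))
...   | true  with () ← out

outsideᵇ-false⇒between : ∀ r₀ r₁ x → outsideᵇ r₀ r₁ x ≡ false → (r₀ < x) × (x < r₁)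
outsideᵇ-false⇒between r₀ r₁ x inside with r₀ <ᵇ x in r₀<ᵇx | x <ᵇ r₁ in x<ᵇr₁
... | true  | true  = <ᵇ-true⇒< r₀<ᵇx , <ᵇ-true⇒< x<ᵇr₁
... | true  | false with () ← inside
... | false | _     with () ← inside

data Config : State → List ℕ → List ℕ → Set where
  empty   : Config empty [] []
  rising  : ∀ {m M S} → DecreasingTo m (M ∷ S) → Config (rising m M) (M ∷ S) []
  twoRuns : ∀ {r₀ r₁ e l o R₁ R₂ out} → DecreasingTo e (l ∷ R₁) → DecreasingTo r₀ (r₁ ∷ R₂) → e < r₀ →
            Decreasing out → last out ≡ o → All (l <_) out → All (Outside r₀ r₁) (out ++ l ∷ R₁) →
            Config (twoRuns r₀ r₁ e l o) ((l ∷ R₁) ++ (r₁ ∷ R₂)) out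

Decreasing-output++upper : ∀ {e l R₁ out} → DecreasingTo e (l ∷ R₁) → Decreasing out → All (l <_) out →
  Decreasing (out ++ l ∷ R₁)
Decreasing-output++upper upper↘ out↘ l<out =
  AllPairsₚ.++⁺ out↘ (DecreasingTo⇒Decreasing upper↘)
    (All.map (λ l<a → All.map (λ b≤l → ≤-<-trans b≤l l<a) (DecreasingTo-≤-head upper↘)) l<out)

below-last : ∀ out o x → Decreasing out → last out ≡ o → belowᵇ o x ≡ true → All (x <_) out
below-last out nothing  x _    last≡ _     rewrite last≡nothing⇒[] out last≡ = []
below-last out (just v) x out↘ last≡ x<ᵇv =
  All.map (<-≤-trans (<ᵇ-true⇒< x<ᵇv)) (Decreasing-last-≤ out out↘ last≡)

Config-newRun : ∀ {r₀ r₁ e l o st out} x {s′} → Config (twoRuns r₀ r₁ e l o) st out → x < e →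
  stepTwoRuns r₀ r₁ e l o x ≡ just s′ → Config s′ (stackAfter x st out) (outputAfter x st out)
Config-newRun {r₀} {r₁} {out = out} x (twoRuns {R₁ = R₁} upper↘ lower↘ e<r₀ out↘ _ l<out outside) x<e eq
  rewrite popWhile-upperRun upper↘ lower↘ e<r₀ x out x<e
        | outsideᵇ-below r₀ r₁ x (<-trans x<e e<r₀) | <⇒<ᵇ-true x<e
  with refl ← eq =
  twoRuns single lower↘ (<-trans x<e e<r₀)
    (Decreasing-output++upper upper↘ out↘ l<out)
    (trans (last-++-∷ out _ R₁) (DecreasingTo-last upper↘))
    (All.++⁺ (All.map (λ l<a → <-≤-trans x<e (≤-trans (DecreasingTo-head-≥ upper↘) (<⇒≤ l<a))) l<out)
             (All.map (<-≤-trans x<e) (DecreasingTo-≥ upper↘)))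
    (All.∷ʳ⁺ outside (inj₁ (<-trans x<e e<r₀)))

Config-extend : ∀ {r₀ r₁ e l o st out} x {s′} → Config (twoRuns r₀ r₁ e l o) st out →
  All (_≢ x) (out ++ st) → e < x →
  stepTwoRuns r₀ r₁ e l o x ≡ just s′ → Config s′ (stackAfter x st out) (outputAfter x st out)
Config-extend {r₀} {r₁} {e} {l} {o} {out = out} x
  (twoRuns {R₁ = R₁} {R₂} upper↘ lower↘ e<r₀ out↘ last≡ _ outside) fresh e<x eq
  rewrite popWhile-stop x ((l ∷ R₁) ++ (r₁ ∷ R₂)) out
            (trans (contains1-23-twoRuns upper↘ lower↘ e<r₀ x) (≥⇒<ᵇ-false (<⇒≤ e<x)))
        | ≥⇒<ᵇ-false {x} {e} (<⇒≤ e<x)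
  with outsideᵇ r₀ r₁ x in x-out | (l <ᵇ x) ∧ belowᵇ o x in extends
... | false | _     with () ← eq
... | true  | false with () ← eq
... | true  | true  with refl ← eq =
  twoRuns (cons (<ᵇ-true⇒< (proj₁ (∧-true⁻ extends))) upper↘) lower↘ e<r₀ out↘ last≡
    (below-last out o x out↘ last≡ (proj₂ (∧-true⁻ extends)))
    (All.++⁺ (All.++⁻ˡ out outside)
             (outsideᵇ⇒Outside r₀ r₁ x x-out x≢r₀ x≢r₁ ∷ All.++⁻ʳ out outside))
  where
  stack-fresh : All (_≢ x) ((l ∷ R₁) ++ (r₁ ∷ R₂))
  stack-fresh = All.++⁻ʳ out fresh
  x≢r₁ : x ≢ r₁
  x≢r₁ x≡r₁ = All.lookup stack-fresh (∈-++⁺ʳ (l ∷ R₁) (here refl)) (sym x≡r₁)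
  x≢r₀ : x ≢ r₀
  x≢r₀ x≡r₀ = All.lookup stack-fresh (∈-++⁺ʳ (l ∷ R₁) (DecreasingTo-∈ lower↘)) (sym x≡r₀)

Config-step : ∀ {s st out} x {s′} → Config s st out → All (_≢ x) (out ++ st) → step s x ≡ just s′ →
  Config s′ (stackAfter x st out) (outputAfter x st out)
Config-step x empty _ refl = rising single
Config-step x (rising {m} {M} {S} dec) _ eq
  rewrite popWhile-stop x (M ∷ S) [] (contains1-23-decreasing dec x) with M <ᵇ x in M<ᵇx
... | true with refl ← eq = rising (cons (<ᵇ-true⇒< M<ᵇx) dec)
... | false with x <ᵇ m in x<ᵇm
...   | true with refl ← eq = twoRuns single dec (<ᵇ-true⇒< x<ᵇm) [] refl [] (inj₁ (<ᵇ-true⇒< x<ᵇm) ∷ [])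
...   | false with () ← eq
Config-step {out = out} x config@(twoRuns {e = e} upper↘ _ _ _ _ _ _) fresh eq with <-cmp x e
... | tri< x<e _ _ = Config-newRun x config x<e eq
... | tri≈ _ x≡e _ = ⊥-elim (All.lookup fresh (∈-++⁺ʳ out (∈-++⁺ˡ (DecreasingTo-∈ upper↘))) (sym x≡e))
... | tri> _ _ e<x = Config-extend x config fresh e<x eq

-- The three ways to fail yield the 231 patterns x r₁ r₀, x l e and v x e (v the last output).
rejection-231-extend : ∀ {r₀ r₁ e l o st out} x → Config (twoRuns r₀ r₁ e l o) st out →
  All (_≢ x) (out ++ st) → e < x → stepTwoRuns r₀ r₁ e l o x ≡ nothing →
  Contains231 (outputAfter x st out ++ stackAfter x st out)
rejection-231-extend {r₀} {r₁} {e} {l} {o} {out = out} x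
  (twoRuns {R₁ = R₁} {R₂} upper↘ lower↘ e<r₀ _ last≡ l<out _) fresh e<x eq
  rewrite popWhile-stop x ((l ∷ R₁) ++ (r₁ ∷ R₂)) out
            (trans (contains1-23-twoRuns upper↘ lower↘ e<r₀ x) (≥⇒<ᵇ-false (<⇒≤ e<x)))
        | ≥⇒<ᵇ-false {x} {e} (<⇒≤ e<x)
  with outsideᵇ r₀ r₁ x in x-out
... | false = let r₀<x , x<r₁ = outsideᵇ-false⇒between r₀ r₁ x x-out in
  occurrence r₀<x x<r₁ (Sublist.++⁺ˡ out (refl ∷ Sublist.++⁺ˡ (l ∷ R₁)
    (refl ∷ from∈ (DecreasingTo-∈-tail lower↘ (>⇒≢ (<-trans r₀<x x<r₁))))))
... | true with l <ᵇ x in l<ᵇx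
...   | false = occurrence e<x x<l (Sublist.++⁺ˡ out (refl ∷ refl ∷
                  Sublist.++⁺ʳ (r₁ ∷ R₂) (from∈ (DecreasingTo-∈-tail upper↘ (>⇒≢ (<-trans e<x x<l))))))
  where
  x<l : x < l
  x<l = ≤∧≢⇒< (<ᵇ-false⇒≥ l<ᵇx) (≢-sym (All.lookup fresh (∈-++⁺ʳ out (here refl))))
...   | true = rejection-below-last o last≡ eq
  where
  rejection-below-last : ∀ o′ → last out ≡ o′ →
    (if belowᵇ o′ x then just (twoRuns r₀ r₁ e x o′) else nothing) ≡ nothing →
    Contains231 (out ++ x ∷ (l ∷ R₁) ++ (r₁ ∷ R₂))
  rejection-below-last (just v) last≡v eq′ with x <ᵇ v in x<ᵇv
  ... | true with () ← eq′
  ... | false = occurrence (≤-<-trans (DecreasingTo-head-≥ upper↘) (All.lookup l<out v∈out)) v<x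
                  (Sublist.++⁺ (from∈ v∈out) (refl ∷ from∈ (∈-++⁺ˡ (DecreasingTo-∈ upper↘))))
    where
    v∈out : v ∈ out
    v∈out = last-∈ out last≡v
    v<x : v < x
    v<x = ≤∧≢⇒< (<ᵇ-false⇒≥ x<ᵇv) (All.lookup (All.++⁻ˡ out fresh) v∈out)

rejection-231 : ∀ {s st out} x → Config s st out → All (_≢ x) (out ++ st) → step s x ≡ nothing →
  Contains231 (outputAfter x st out ++ stackAfter x st out)
rejection-231 x (rising {m} {M} {S} dec) fresh eq
  rewrite popWhile-stop x (M ∷ S) [] (contains1-23-decreasing dec x) with M <ᵇ x in M<ᵇx
... | true with () ← eq
... | false with x <ᵇ m in x<ᵇm
...   | true with () ← eq
...   | false = occurrence m<x x<M (refl ∷ refl ∷ from∈ (DecreasingTo-∈-tail dec (>⇒≢ (<-trans m<x x<M))))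
  where
  m<x : m < x
  m<x = ≤∧≢⇒< (<ᵇ-false⇒≥ x<ᵇm) (All.lookup fresh (DecreasingTo-∈ dec))
  x<M : x < M
  x<M = ≤∧≢⇒< (<ᵇ-false⇒≥ M<ᵇx) (≢-sym (All.lookup fresh (here refl)))
rejection-231 {out = out} x config@(twoRuns {r₀} {r₁} {e} upper↘ _ e<r₀ _ _ _ _) fresh eq with <-cmp x e
... | tri< x<e _ _ rewrite outsideᵇ-below r₀ r₁ x (<-trans x<e e<r₀) | <⇒<ᵇ-true x<e with () ← eq
... | tri≈ _ x≡e _ = ⊥-elim (All.lookup fresh (∈-++⁺ʳ out (∈-++⁺ˡ (DecreasingTo-∈ upper↘))) (sym x≡e))
... | tri> _ _ e<x = rejection-231-extend x config fresh e<x eq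

Decreasing-split : ∀ r₀ r₁ D → Decreasing D → All (Outside r₀ r₁) D →
  Σ (List ℕ) λ H → Σ (List ℕ) λ L → (D ≡ H ++ L) × All (r₁ <_) H × All (_< r₀) L
Decreasing-split r₀ r₁ []      _             _                   = [] , [] , refl , [] , []
Decreasing-split r₀ r₁ (x ∷ D) (x>D ∷ _)     (inj₁ x<r₀ ∷ _)     =
  [] , x ∷ D , refl , [] , x<r₀ ∷ All.map (λ z<x → <-trans z<x x<r₀) x>D
Decreasing-split r₀ r₁ (x ∷ D) (_ ∷ decD)    (inj₂ r₁<x ∷ outD) with Decreasing-split r₀ r₁ D decD outD
... | H , L , refl , r₁<H , L<r₀ = x ∷ H , L , refl , r₁<x ∷ r₁<H , L<r₀

westSort-outside-lower : ∀ r₀ r₁ D U → Decreasing D → All (Outside r₀ r₁) D → DecreasingTo r₀ (r₁ ∷ U) →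
  Increasing (westSort (D ++ r₁ ∷ U))
westSort-outside-lower r₀ r₁ D U decD outD lower↘ with Decreasing-split r₀ r₁ D decD outD
... | H , L , refl , r₁<H , L<r₀ rewrite ++-assoc H L (r₁ ∷ U) =
  subst Increasing (sym (westSort-blocks H L r₁ U decHUL)) (AllPairs-reverse⁺ decHUL)
  where
  decHUL : Decreasing (H ++ (r₁ ∷ U) ++ L)
  decHUL = AllPairsₚ.++⁺ (AllPairs-++⁻ˡ H decD)
             (AllPairsₚ.++⁺ (DecreasingTo⇒Decreasing lower↘) (AllPairs-++⁻ʳ H decD)
               (All.map (λ r₀≤u → All.map (λ l<r₀ → <-≤-trans l<r₀ r₀≤u) L<r₀) (DecreasingTo-≥ lower↘)))
             (All.zipWith (λ (r₁<h , h>L) →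
                All.++⁺ (All.map (λ u≤r₁ → ≤-<-trans u≤r₁ r₁<h) (DecreasingTo-≤-head lower↘)) h>L)
               (r₁<H , AllPairs-++⁻-across H decD))

westSort-Config : ∀ {s st out} → Config s st out → Increasing (westSort (out ++ st))
westSort-Config empty = []
westSort-Config (rising {m} {M} {S} dec) = westSort-outside-lower m M [] S [] [] dec
westSort-Config (twoRuns {r₀ = r₀} {r₁} {l = l} {R₁ = R₁} {R₂} {out} upper↘ lower↘ _ out↘ _ l<out outside)
  rewrite sym (++-assoc out (l ∷ R₁) (r₁ ∷ R₂)) =
  westSort-outside-lower r₀ r₁ (out ++ l ∷ R₁) R₂ (Decreasing-output++upper upper↘ out↘ l<out) outside lower↘

accepted⇒sorted : ∀ xs {s st out} → Config s st out → Unique (out ++ st ++ xs) →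
  accepts s xs ≡ true → Increasing (westSort (stackMapGo xs st out))
accepted⇒sorted []       config _    _        = westSort-Config config
accepted⇒sorted (x ∷ xs) {s} {st} {out} config uniq accepted with step s x in eq
... | just s′ = accepted⇒sorted xs (Config-step x config (Unique-fresh x st out xs uniq) eq)
                  (Unique-step x st out xs uniq) accepted

rejected⇒231 : ∀ xs {s st out} → Config s st out → Unique (out ++ st ++ xs) →
  accepts s xs ≡ false → Contains231 (stackMapGo xs st out)
rejected⇒231 (x ∷ xs) {s} {st} {out} config uniq rejected with step s x in eq
... | nothing = Contains231-⊆ (stackMapGo-⊇ xs (stackAfter x st out) (outputAfter x st out))
                  (rejection-231 x config (Unique-fresh x st out xs uniq) eq)
... | just s′ = rejected⇒231 xs (Config-step x config (Unique-fresh x st out xs uniq) eq)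
                  (Unique-step x st out xs uniq) rejected

westSort∘stackMap-↭ : ∀ τ → westSort (stackMap1-23 τ) ↭ τ
westSort∘stackMap-↭ τ = ↭-trans (westGo-↭ (stackMap1-23 τ) [] []) (stackMapGo-↭ τ [] [])

sortable⇔accepted : ∀ n τ → τ ↭ idPerm n →
  does (≡-dec _≟_ (westSort (stackMap1-23 τ)) (idPerm n)) ≡ accepts empty τ
sortable⇔accepted n τ τ↭ with accepts empty τ in acceptance
  | ≡-dec _≟_ (westSort (stackMap1-23 τ)) (idPerm n)
... | true  | yes _ = refl
... | true  | no ≢id = ⊥-elim (≢id (Increasing-↭⇒≡
                        (accepted⇒sorted τ empty (Unique-↭-idPerm n τ↭) acceptance) (Increasing-idPerm n)
                        (↭-trans (westSort∘stackMap-↭ τ) τ↭)))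
... | false | no _  = refl
... | false | yes ≡id with westSort-231 _ (rejected⇒231 τ empty (Unique-↭-idPerm n τ↭) acceptance)
...   | inversion b<a ab⊆ = ⊥-elim (<-asym b<a (AllPairs-⊆-pair (Increasing-idPerm n) (subst (_ ⊆_) ≡id ab⊆)))

nothing-rejects : ∀ {A : Set} {xs} → is-just (run nothing xs) ≡ true → A
nothing-rejects ()

stepTwoRuns-cases : ∀ r₀ r₁ e l o x → (stepTwoRuns r₀ r₁ e l o x ≡ nothing)
  ⊎ (stepTwoRuns r₀ r₁ e l o x ≡ just (twoRuns r₀ r₁ x x (just e)))
  ⊎ (stepTwoRuns r₀ r₁ e l o x ≡ just (twoRuns r₀ r₁ e x o))
stepTwoRuns-cases r₀ r₁ e l o x with outsideᵇ r₀ r₁ x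
... | false = inj₁ refl
... | true with x <ᵇ e
...   | true = inj₂ (inj₁ refl)
...   | false with (l <ᵇ x) ∧ belowᵇ o x
...     | true  = inj₂ (inj₂ refl)
...     | false = inj₁ refl

accepts-widen : ∀ r₀ r₁ r₀′ r₁′ → (∀ x → outsideᵇ r₀ r₁ x ≡ true → outsideᵇ r₀′ r₁′ x ≡ true) →
  ∀ e l o ys → accepts (twoRuns r₀ r₁ e l o) ys ≡ true → accepts (twoRuns r₀′ r₁′ e l o) ys ≡ true
accepts-widen r₀ r₁ r₀′ r₁′ widen e l o []       _   = refl
accepts-widen r₀ r₁ r₀′ r₁′ widen e l o (x ∷ xs) acc with outsideᵇ r₀ r₁ x in x-out
... | false = nothing-rejects {xs = xs} acc
... | true rewrite widen x x-out with x <ᵇ e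
...   | true = accepts-widen r₀ r₁ r₀′ r₁′ widen x x (just e) xs acc
...   | false with (l <ᵇ x) ∧ belowᵇ o x
...     | true  = accepts-widen r₀ r₁ r₀′ r₁′ widen e x o xs acc
...     | false = nothing-rejects {xs = xs} acc

accepts-emptyRange : ∀ r e l o ys → accepts (twoRuns r r e l o) ys ≡ accepts (twoRuns 0 0 e l o) ys
accepts-emptyRange r e l o ys = Bool-ext (accepts-widen r r 0 0 (λ x _ → outsideᵇ-empty 0 x) e l o ys)
                                         (accepts-widen 0 0 r r (λ x _ → outsideᵇ-empty r x) e l o ys)

-- Below a bound v ≤ r₀ on future entries, the forbidden range (r₀, r₁) is never reached.
accepts-bounded-anyRange : ∀ p₀ p₁ r₀ r₁ e l v ys → e ≤ r₀ → v ≤ r₀ →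
  accepts (twoRuns p₀ p₁ e l (just v)) ys ≡ true → accepts (twoRuns r₀ r₁ e l (just v)) ys ≡ true
accepts-bounded-anyRange p₀ p₁ r₀ r₁ e l v []       _   _   _   = refl
accepts-bounded-anyRange p₀ p₁ r₀ r₁ e l v (x ∷ xs) e≤r₀ v≤r₀ acc with outsideᵇ p₀ p₁ x
... | false = nothing-rejects {xs = xs} acc
... | true with x <ᵇ e in x<ᵇe
...   | true rewrite outsideᵇ-below r₀ r₁ x (<-≤-trans (<ᵇ-true⇒< x<ᵇe) e≤r₀) =
          accepts-bounded-anyRange p₀ p₁ r₀ r₁ x x e xs (<⇒≤ (<-≤-trans (<ᵇ-true⇒< x<ᵇe) e≤r₀)) e≤r₀ acc
...   | false with l <ᵇ x
...     | false = nothing-rejects {xs = xs} acc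
...     | true with x <ᵇ v in x<ᵇv
...       | false = nothing-rejects {xs = xs} acc
...       | true rewrite outsideᵇ-below r₀ r₁ x (<-≤-trans (<ᵇ-true⇒< x<ᵇv) v≤r₀) =
            accepts-bounded-anyRange p₀ p₁ r₀ r₁ e x v xs e≤r₀ v≤r₀ acc

accepts-bound⇒open : ∀ p₀ p₁ r₀ r₁ e l ys → e < r₀ →
  accepts (twoRuns p₀ p₁ e l (just r₀)) ys ≡ true → accepts (twoRuns r₀ r₁ e l nothing) ys ≡ true
accepts-bound⇒open p₀ p₁ r₀ r₁ e l []       _    _   = refl
accepts-bound⇒open p₀ p₁ r₀ r₁ e l (x ∷ xs) e<r₀ acc with outsideᵇ p₀ p₁ x
... | false = nothing-rejects {xs = xs} acc
... | true with x <ᵇ e in x<ᵇe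
...   | true rewrite outsideᵇ-below r₀ r₁ x (<-trans (<ᵇ-true⇒< x<ᵇe) e<r₀) =
          accepts-bounded-anyRange p₀ p₁ r₀ r₁ x x e xs (<⇒≤ (<-trans (<ᵇ-true⇒< x<ᵇe) e<r₀)) (<⇒≤ e<r₀) acc
...   | false with l <ᵇ x
...     | false = nothing-rejects {xs = xs} acc
...     | true with x <ᵇ r₀ in x<ᵇr₀
...       | false = nothing-rejects {xs = xs} acc
...       | true rewrite outsideᵇ-below r₀ r₁ x (<ᵇ-true⇒< x<ᵇr₀) =
            accepts-bound⇒open p₀ p₁ r₀ r₁ e x xs e<r₀ acc

outsideᵇ-below-top : ∀ r₀ N x → outsideᵇ r₀ N x ≡ true → x < N → x ≢ r₀ → x < r₀
outsideᵇ-below-top r₀ N x x-out x<N x≢r₀ with r₀ <ᵇ x in r₀<ᵇx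
... | false = ≤∧≢⇒< (<ᵇ-false⇒≥ r₀<ᵇx) x≢r₀
... | true rewrite <⇒<ᵇ-true x<N with () ← x-out

accepts-open⇒bound : ∀ N r₀ e l ys → All (_< N) ys → All (_≢ r₀) ys →
  accepts (twoRuns r₀ N e l nothing) ys ≡ true → accepts (twoRuns 0 0 e l (just r₀)) ys ≡ true
accepts-open⇒bound N r₀ e l []       _            _            _   = refl
accepts-open⇒bound N r₀ e l (x ∷ xs) (x<N ∷ xs<N) (x≢r₀ ∷ xs≢r₀) acc with outsideᵇ r₀ N x in x-out
... | false = nothing-rejects {xs = xs} acc
... | true rewrite outsideᵇ-empty 0 x with x <ᵇ e
...   | true = accepts-widen r₀ N 0 0 (λ z _ → outsideᵇ-empty 0 z) x x (just e) xs acc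
...   | false with l <ᵇ x
...     | false = nothing-rejects {xs = xs} acc
...     | true rewrite <⇒<ᵇ-true (outsideᵇ-below-top r₀ N x x-out x<N x≢r₀) =
          accepts-open⇒bound N r₀ e x xs xs<N xs≢r₀ acc

accepts-bound-vacuous : ∀ r₀ r₁ e l v ys → All (_< v) ys →
  accepts (twoRuns r₀ r₁ e l (just v)) ys ≡ accepts (twoRuns r₀ r₁ e l nothing) ys
accepts-bound-vacuous r₀ r₁ e l v []       _            = refl
accepts-bound-vacuous r₀ r₁ e l v (x ∷ xs) (x<v ∷ xs<v) with outsideᵇ r₀ r₁ x
... | false = refl
... | true with x <ᵇ e
...   | true = refl
...   | false rewrite <⇒<ᵇ-true x<v with l <ᵇ x
...     | true  = accepts-bound-vacuous r₀ r₁ e x v xs xs<v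
...     | false = refl

data Phase : Set where
  rejected ascending descended : Phase

phase : Maybe State → Phase
phase nothing                    = rejected
phase (just (twoRuns _ _ _ _ _)) = descended
phase (just _)                   = ascending

descendedIf : Bool → Phase
descendedIf true  = descended
descendedIf false = rejected

phase-twoRuns : ∀ r₀ r₁ e l o ys →
  phase (run (just (twoRuns r₀ r₁ e l o)) ys) ≡ descendedIf (accepts (twoRuns r₀ r₁ e l o) ys)
phase-twoRuns r₀ r₁ e l o []       = refl
phase-twoRuns r₀ r₁ e l o (y ∷ ys) with stepTwoRuns-cases r₀ r₁ e l o y
... | inj₁ eq        rewrite eq = refl
... | inj₂ (inj₁ eq) rewrite eq = phase-twoRuns r₀ r₁ y y (just e) ys
... | inj₂ (inj₂ eq) rewrite eq = phase-twoRuns r₀ r₁ e y o ys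

descendedIf≢ascending : ∀ b → descendedIf b ≢ ascending
descendedIf≢ascending true  ()
descendedIf≢ascending false ()

ascending⇒accepts-afterMax : ∀ m M e ys → e ≤ M → phase (run (just (rising m M)) ys) ≡ ascending →
  accepts (twoRuns 0 0 e M nothing) ys ≡ true
ascending⇒accepts-afterMax m M e []       _   _   = refl
ascending⇒accepts-afterMax m M e (x ∷ xs) e≤M asc with M <ᵇ x in M<ᵇx
... | true rewrite outsideᵇ-empty 0 x | ≥⇒<ᵇ-false {x} {e} (<⇒≤ (≤-<-trans e≤M (<ᵇ-true⇒< M<ᵇx))) =
        ascending⇒accepts-afterMax m x e xs (<⇒≤ (≤-<-trans e≤M (<ᵇ-true⇒< M<ᵇx))) asc
... | false with x <ᵇ m
...   | true  = ⊥-elim (descendedIf≢ascending _ (trans (sym (phase-twoRuns m M x x nothing xs)) asc))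
...   | false with () ← asc

accepts-afterMax⇒accepts-rising : ∀ m M ys → m ≤ M → accepts (twoRuns 0 0 m M nothing) ys ≡ true →
  accepts (rising m M) ys ≡ true
accepts-afterMax⇒accepts-rising m M []       _   _   = refl
accepts-afterMax⇒accepts-rising m M (x ∷ xs) m≤M acc rewrite outsideᵇ-empty 0 x with x <ᵇ m in x<ᵇm
... | true rewrite ≥⇒<ᵇ-false {M} {x} (<⇒≤ (<-≤-trans (<ᵇ-true⇒< x<ᵇm) m≤M)) =
        accepts-bound⇒open 0 0 m M x x xs (<ᵇ-true⇒< x<ᵇm) acc
... | false with M <ᵇ x in M<ᵇx
...   | true  = accepts-afterMax⇒accepts-rising m x xs (≤-trans m≤M (<⇒≤ (<ᵇ-true⇒< M<ᵇx))) acc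
...   | false = nothing-rejects {xs = xs} acc

-- Counting the insertions of a new maximum

𝟙 : Bool → ℕ
𝟙 true  = 1
𝟙 false = 0

count : {X : Set} → (X → Bool) → List X → ℕ
count p []       = 0
count p (x ∷ xs) = 𝟙 (p x) + count p xs

count-map : {X Y : Set} (p : Y → Bool) (g : X → Y) (xs : List X) → count p (map g xs) ≡ count (λ x → p (g x)) xs
count-map p g []       = refl
count-map p g (x ∷ xs) = cong (𝟙 (p (g x)) +_) (count-map p g xs)

count-cong : {X : Set} {p q : X → Bool} (xs : List X) → All (λ x → p x ≡ q x) xs → count p xs ≡ count q xs
count-cong []       []            = refl
count-cong (x ∷ xs) (px≡qx ∷ eqs) = cong₂ _+_ (cong 𝟙 px≡qx) (count-cong xs eqs)

count-++ : {X : Set} (p : X → Bool) (xs ys : List X) → count p (xs ++ ys) ≡ count p xs + count p ys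
count-++ p []       ys = refl
count-++ p (x ∷ xs) ys = trans (cong (𝟙 (p x) +_) (count-++ p xs ys)) (sym (+-assoc (𝟙 (p x)) _ _))

-- A criterion judges the phase of a run on a word together with whether a parallel run
-- (started at afterMax, so in effect on the word behind a new maximum) accepts it.
Criterion : Set
Criterion = Phase → Bool → Bool

holds : Criterion → Maybe State → Maybe State → List ℕ → Bool
holds F ms mp z = F (phase (run ms z)) (is-just (run mp z))

Strict : Criterion → Set
Strict F = ∀ q → F rejected q ≡ false

count-insertions-∷ : ∀ N F ms mp y ys → count (holds F ms mp) (insertions N (y ∷ ys)) ≡
  𝟙 (holds F ms mp (N ∷ y ∷ ys)) + count (holds F (advance ms y) (advance mp y)) (insertions N ys)
count-insertions-∷ N F ms mp y ys = cong (𝟙 (holds F ms mp (N ∷ y ∷ ys)) +_) (begin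
  count (holds F ms mp) (map (y ∷_) (insertions N ys))        ≡⟨ count-map (holds F ms mp) (y ∷_) (insertions N ys) ⟩
  count (λ z → holds F ms mp (y ∷ z)) (insertions N ys)      ≡⟨ count-cong (insertions N ys) (All.universal holds-∷ _) ⟩
  count (holds F (advance ms y) (advance mp y)) (insertions N ys) ∎)
  where
  open ≡-Reasoning
  holds-∷ : ∀ z → holds F ms mp (y ∷ z) ≡ holds F (advance ms y) (advance mp y) z
  holds-∷ z rewrite run-∷ ms y z | run-∷ mp y z = refl

count-insertions-rejected : ∀ N F → Strict F → ∀ mp ys → count (holds F nothing mp) (insertions N ys) ≡ 0
count-insertions-rejected N F strict mp []       = cong (λ b → 𝟙 b + 0) (strict _)
count-insertions-rejected N F strict mp (y ∷ ys)
  rewrite count-insertions-∷ N F nothing mp y ys | strict (is-just (run mp (N ∷ y ∷ ys))) =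
  count-insertions-rejected N F strict (advance mp y) ys

stepTwoRuns-above : ∀ r₀ r₁ e l v N → e < N → v < N → stepTwoRuns r₀ r₁ e l (just v) N ≡ nothing
stepTwoRuns-above r₀ r₁ e l v N e<N v<N with outsideᵇ r₀ r₁ N
... | false = refl
... | true rewrite ≥⇒<ᵇ-false {N} {e} (<⇒≤ e<N) | ≥⇒<ᵇ-false {N} {v} (<⇒≤ v<N) with l <ᵇ N
...   | true  = refl
...   | false = refl

-- Once something has been output, a new maximum N can never be read.
count-insertions-closed : ∀ N F → Strict F → ∀ r₀ r₁ e l v mp ys → e < N → v < N → All (_< N) ys →
  count (holds F (just (twoRuns r₀ r₁ e l (just v))) mp) (insertions N ys) ≡ 0
count-insertions-closed N F strict r₀ r₁ e l v mp [] e<N v<N _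
  rewrite stepTwoRuns-above r₀ r₁ e l v N e<N v<N | strict (is-just (run mp (N ∷ []))) = refl
count-insertions-closed N F strict r₀ r₁ e l v mp (y ∷ ys) e<N v<N (y<N ∷ ys<N)
  rewrite count-insertions-∷ N F (just (twoRuns r₀ r₁ e l (just v))) mp y ys
        | stepTwoRuns-above r₀ r₁ e l v N e<N v<N | strict (is-just (run mp (N ∷ y ∷ ys)))
  with stepTwoRuns-cases r₀ r₁ e l (just v) y
... | inj₁ eq        rewrite eq = count-insertions-rejected N F strict (advance mp y) ys
... | inj₂ (inj₁ eq) rewrite eq = count-insertions-closed N F strict r₀ r₁ y y e (advance mp y) ys y<N e<N ys<N
... | inj₂ (inj₂ eq) rewrite eq = count-insertions-closed N F strict r₀ r₁ e y v (advance mp y) ys e<N v<N ys<N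

DiesOn : ℕ → Maybe State → Set
DiesOn N nothing                          = ⊤
DiesOn N (just (twoRuns _ _ e _ (just v))) = (e < N) × (v < N)
DiesOn N (just _)                         = ⊥

DiesOn-rejects : ∀ N mp zs → DiesOn N mp → run mp (N ∷ zs) ≡ nothing
DiesOn-rejects N nothing                               zs _            = refl
DiesOn-rejects N (just (twoRuns r₀ r₁ e l (just v))) zs (e<N , v<N)
  rewrite stepTwoRuns-above r₀ r₁ e l v N e<N v<N = refl

DiesOn-advance : ∀ N mp y → DiesOn N mp → y < N → DiesOn N (advance mp y)
DiesOn-advance N nothing                               y _            _   = tt
DiesOn-advance N (just (twoRuns r₀ r₁ e l (just v))) y (e<N , v<N) y<N with stepTwoRuns-cases r₀ r₁ e l (just v) y
... | inj₁ eq        rewrite eq = tt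
... | inj₂ (inj₁ eq) rewrite eq = y<N , e<N
... | inj₂ (inj₂ eq) rewrite eq = e<N , v<N

stepTwoRuns-open-max : ∀ r₀ r₁ e l N → r₁ ≤ N → e < N → l < N →
  stepTwoRuns r₀ r₁ e l nothing N ≡ just (twoRuns r₀ r₁ e N nothing)
stepTwoRuns-open-max r₀ r₁ e l N r₁≤N e<N l<N
  rewrite ≥⇒<ᵇ-false {N} {r₁} r₁≤N | ≥⇒<ᵇ-false {N} {e} (<⇒≤ e<N) | <⇒<ᵇ-true l<N with r₀ <ᵇ N
... | true  = refl
... | false = refl

-- With nothing output yet, N can only survive at the end of the current upper run, where it
-- changes neither acceptance nor phase; the parallel run dies on N.
count-insertions-open : ∀ N F → Strict F → ∀ r₀ r₁ e l mp ys → DiesOn N mp → r₁ ≤ N → e < N → l < N →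
  All (_< N) ys →
  count (holds F (just (twoRuns r₀ r₁ e l nothing)) mp) (insertions N ys)
    ≡ 𝟙 (F (phase (run (just (twoRuns r₀ r₁ e l nothing)) ys)) false)
count-insertions-open N F strict r₀ r₁ e l mp [] dies r₁≤N e<N l<N _
  rewrite stepTwoRuns-open-max r₀ r₁ e l N r₁≤N e<N l<N | DiesOn-rejects N mp [] dies = +-identityʳ _
count-insertions-open N F strict r₀ r₁ e l mp (y ∷ ys) dies r₁≤N e<N l<N (y<N ∷ ys<N)
  rewrite count-insertions-∷ N F (just (twoRuns r₀ r₁ e l nothing)) mp y ys
        | stepTwoRuns-open-max r₀ r₁ e l N r₁≤N e<N l<N | DiesOn-rejects N mp (y ∷ ys) dies
        | ≥⇒<ᵇ-false {N} {y} (<⇒≤ y<N)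
  with outsideᵇ r₀ r₁ y
... | false rewrite count-insertions-rejected N F strict (advance mp y) ys = +-identityʳ _
... | true with y <ᵇ e
...   | true rewrite count-insertions-closed N F strict r₀ r₁ y y e (advance mp y) ys y<N e<N ys<N = +-identityʳ _
...   | false rewrite strict false with l <ᵇ y
...     | true  = count-insertions-open N F strict r₀ r₁ e y (advance mp y) ys (DiesOn-advance N mp y dies y<N)
                    r₁≤N e<N y<N ys<N
...     | false rewrite count-insertions-rejected N F strict (advance mp y) ys = sym (cong 𝟙 (strict false))

-- After the first descent, N survives at most in front of it (where the two runs accept
-- together, c) and at the end of the next upper run (c′, with the parallel run dead); SplitsAs F G
-- says that these two contributions to F add up to G.
SplitsAs : Criterion → Criterion → Set
SplitsAs F G = ∀ c c′ → (c ≡ true → c′ ≡ true) →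
  𝟙 (F (descendedIf c) c) + 𝟙 (F (descendedIf c′) false) ≡ 𝟙 (G (descendedIf c′) c)

count-insertions-rising : ∀ N F G → Strict F → Strict G → 𝟙 (F ascending true) ≡ 𝟙 (G ascending true) →
  SplitsAs F G → ∀ m M ys → m ≤ M → M < N → All (_< N) ys → All (_≢ m) ys →
  count (holds F (just (rising m M)) (just (twoRuns 0 0 m M nothing))) (insertions N ys)
    ≡ 𝟙 (G (phase (run (just (rising m M)) ys)) (accepts (twoRuns 0 0 m M nothing) ys))
count-insertions-rising N F G strictF strictG base splits m M [] m≤M M<N _ _
  rewrite <⇒<ᵇ-true M<N | outsideᵇ-empty 0 N | ≥⇒<ᵇ-false {N} {m} (<⇒≤ (≤-<-trans m≤M M<N)) =
  trans (+-identityʳ _) base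
count-insertions-rising N F G strictF strictG base splits m M (y ∷ ys) m≤M M<N (y<N ∷ ys<N) (y≢m ∷ ys≢m)
  rewrite count-insertions-∷ N F (just (rising m M)) (just (twoRuns 0 0 m M nothing)) y ys
        | <⇒<ᵇ-true M<N | outsideᵇ-empty 0 N | ≥⇒<ᵇ-false {N} {m} (<⇒≤ (≤-<-trans m≤M M<N))
        | ≥⇒<ᵇ-false {N} {y} (<⇒≤ y<N) | outsideᵇ-empty 0 y
  with M <ᵇ y in M<ᵇy
... | true rewrite ≥⇒<ᵇ-false {y} {m} (≤-trans m≤M (<⇒≤ (<ᵇ-true⇒< M<ᵇy))) | strictF false =
  count-insertions-rising N F G strictF strictG base splits m y ys (≤-trans m≤M (<⇒≤ (<ᵇ-true⇒< M<ᵇy))) y<N ys<N ys≢m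
... | false with y <ᵇ m in y<ᵇm
...   | true
  rewrite count-insertions-open N F strictF m M y y (just (twoRuns 0 0 y y (just m))) ys
            (y<N , ≤-<-trans m≤M M<N) (<⇒≤ M<N) y<N y<N ys<N
        | phase-twoRuns m N y y nothing ys | phase-twoRuns m M y y nothing ys
        | Bool-ext (accepts-open⇒bound N m y y ys ys<N ys≢m) (accepts-bound⇒open 0 0 m N y y ys (<ᵇ-true⇒< y<ᵇm))
  = splits (accepts (twoRuns 0 0 y y (just m)) ys) (accepts (twoRuns m M y y nothing) ys)
           (accepts-bound⇒open 0 0 m M y y ys (<ᵇ-true⇒< y<ᵇm))
...   | false rewrite count-insertions-rejected N F strictF nothing ys | strictF false | strictG false = refl

count-insertions-start : ∀ N F G → Strict F → Strict G → 𝟙 (F ascending true) ≡ 𝟙 (G ascending true) →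
  SplitsAs F G → ∀ y ys → y < N → All (_< N) ys → All (_≢ y) ys →
  count (holds F (just empty) (just afterMax)) (insertions N (y ∷ ys))
    ≡ 𝟙 (F (descendedIf (accepts (twoRuns 0 0 y y nothing) ys)) (accepts (twoRuns 0 0 y y nothing) ys))
      + 𝟙 (G (phase (run (just (rising y y)) ys)) (accepts (twoRuns 0 0 y y nothing) ys))
count-insertions-start N F G strictF strictG base splits y ys y<N ys<N ys≢y
  rewrite count-insertions-∷ N F (just empty) (just afterMax) y ys
        | ≥⇒<ᵇ-false {N} {y} (<⇒≤ y<N) | <⇒<ᵇ-true y<N | outsideᵇ-empty 0 y
        | phase-twoRuns N N y y nothing ys | accepts-emptyRange N y y nothing ys
        | accepts-bound-vacuous 0 0 y y N ys ys<N
  = cong (_ +_) (count-insertions-rising N F G strictF strictG base splits y y ys ≤-refl y<N ys<N ys≢y)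

-- The classes I, P, N and their recurrences

isIdentity isPrefixable isUnprefixable hasDescended : Criterion
isIdentity ascending _ = true
isIdentity _         _ = false
isPrefixable descended q = q
isPrefixable _         _ = false
isUnprefixable descended q = not q
isUnprefixable _         _ = false
hasDescended descended _ = true
hasDescended _         _ = false

classI classP classN : List ℕ → Bool
classI = holds isIdentity     (just empty) (just afterMax)
classP = holds isPrefixable   (just empty) (just afterMax)
classN = holds isUnprefixable (just empty) (just afterMax)

accepts-classes : ∀ τ → 𝟙 (accepts empty τ) ≡ 𝟙 (classI τ) + 𝟙 (classP τ) + 𝟙 (classN τ)
accepts-classes τ = by-phase (run (just empty) τ) (accepts afterMax τ)
  where
  by-phase : ∀ ms q → 𝟙 (is-just ms) ≡ 𝟙 (isIdentity (phase ms) q) + 𝟙 (isPrefixable (phase ms) q)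
                                       + 𝟙 (isUnprefixable (phase ms) q)
  by-phase nothing                          q     = refl
  by-phase (just empty)                     q     = refl
  by-phase (just afterMax)                  q     = refl
  by-phase (just (rising _ _))              q     = refl
  by-phase (just (twoRuns _ _ _ _ _)) true  = refl
  by-phase (just (twoRuns _ _ _ _ _)) false = refl

splitsAs-I : SplitsAs isIdentity isIdentity
splitsAs-I true  true  _ = refl
splitsAs-I true  false _ = refl
splitsAs-I false true  _ = refl
splitsAs-I false false _ = refl

splitsAs-P : SplitsAs isPrefixable isPrefixable
splitsAs-P true  true  _   = refl
splitsAs-P true  false c⇒c′ with () ← c⇒c′ refl
splitsAs-P false true  _   = refl
splitsAs-P false false _   = refl

splitsAs-N : SplitsAs isUnprefixable hasDescended
splitsAs-N true  true  _   = refl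
splitsAs-N true  false c⇒c′ with () ← c⇒c′ refl
splitsAs-N false true  _   = refl
splitsAs-N false false _   = refl

phase-rejected⇒rejects : ∀ ms → phase ms ≡ rejected → is-just ms ≡ false
phase-rejected⇒rejects nothing                    _  = refl
phase-rejected⇒rejects (just empty)               ()
phase-rejected⇒rejects (just afterMax)            ()
phase-rejected⇒rejects (just (rising _ _))        ()
phase-rejected⇒rejects (just (twoRuns _ _ _ _ _)) ()

module _ (N y : ℕ) (ys : List ℕ) (y<N : y < N) (ys<N : All (_< N) ys) (ys≢y : All (_≢ y) ys) where

  count-insertions-I : count classI (insertions N (y ∷ ys)) ≡ 𝟙 (classI (y ∷ ys))
  count-insertions-I =
    trans (count-insertions-start N isIdentity isIdentity (λ _ → refl) (λ _ → refl) refl splitsAs-I y ys y<N ys<N ys≢y)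
          (cong (_+ 𝟙 (classI (y ∷ ys))) (never-identity (accepts (twoRuns 0 0 y y nothing) ys)))
    where
    never-identity : ∀ c → 𝟙 (isIdentity (descendedIf c) c) ≡ 0
    never-identity true  = refl
    never-identity false = refl

  count-insertions-P : count classP (insertions N (y ∷ ys)) ≡ 𝟙 (classI (y ∷ ys)) + 2 * 𝟙 (classP (y ∷ ys))
  count-insertions-P =
    trans (count-insertions-start N isPrefixable isPrefixable (λ _ → refl) (λ _ → refl) refl splitsAs-P y ys y<N ys<N ys≢y)
          (arithmetic (phase (run (just (rising y y)) ys)) (accepts (twoRuns 0 0 y y nothing) ys)
             (ascending⇒accepts-afterMax y y y ys ≤-refl)
             (λ acc rej → true≢false (trans (sym (accepts-afterMax⇒accepts-rising y y ys ≤-refl acc))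
                                             (phase-rejected⇒rejects _ rej))))
    where
    true≢false : true ≢ false
    true≢false ()
    arithmetic : ∀ k c → (k ≡ ascending → c ≡ true) → (c ≡ true → k ≡ rejected → ⊥) →
      𝟙 (isPrefixable (descendedIf c) c) + 𝟙 (isPrefixable k c) ≡ 𝟙 (isIdentity k c) + 2 * 𝟙 (isPrefixable k c)
    arithmetic ascending true  _   _   = refl
    arithmetic ascending false asc _   with () ← asc refl
    arithmetic descended true  _   _   = refl
    arithmetic descended false _   _   = refl
    arithmetic rejected  true  _   rej = ⊥-elim (rej refl refl)
    arithmetic rejected  false _   _   = refl

  count-insertions-N : count classN (insertions N (y ∷ ys)) ≡ 𝟙 (classP (y ∷ ys)) + 𝟙 (classN (y ∷ ys))
  count-insertions-N =
    trans (count-insertions-start N isUnprefixable hasDescended (λ _ → refl) (λ _ → refl) refl splitsAs-N y ys y<N ys<N ys≢y)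
          (arithmetic (phase (run (just (rising y y)) ys)) (accepts (twoRuns 0 0 y y nothing) ys))
    where
    arithmetic : ∀ k c → 𝟙 (isUnprefixable (descendedIf c) c) + 𝟙 (hasDescended k c)
                         ≡ 𝟙 (isPrefixable k c) + 𝟙 (isUnprefixable k c)
    arithmetic ascending true  = refl
    arithmetic ascending false = refl
    arithmetic descended true  = refl
    arithmetic descended false = refl
    arithmetic rejected  true  = refl
    arithmetic rejected  false = refl

regroup : ∀ a b c d k → (a + k * b) + (c + k * d) ≡ (a + c) + k * (b + d)
regroup = solve 5 (λ a b c d k → (a :+ k :* b) :+ (c :+ k :* d) := (a :+ c) :+ k :* (b :+ d)) refl
  where open +-*-Solver

count-concatMap-linear : {A B : Set} (p : B → Bool) (g : A → List B) (q r : A → Bool) (k : ℕ) (L : List A) →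
  All (λ σ → count p (g σ) ≡ 𝟙 (q σ) + k * 𝟙 (r σ)) L →
  count p (concatMap g L) ≡ count q L + k * count r L
count-concatMap-linear p g q r k []      []           = sym (*-zeroʳ k)
count-concatMap-linear p g q r k (σ ∷ L) (eqσ ∷ eqL) = begin
  count p (g σ ++ concatMap g L)                        ≡⟨ count-++ p (g σ) (concatMap g L) ⟩
  count p (g σ) + count p (concatMap g L)               ≡⟨ cong₂ _+_ eqσ (count-concatMap-linear p g q r k L eqL) ⟩
  (𝟙 (q σ) + k * 𝟙 (r σ)) + (count q L + k * count r L) ≡⟨ regroup (𝟙 (q σ)) (𝟙 (r σ)) (count q L) (count r L) k ⟩
  (𝟙 (q σ) + count q L) + k * (𝟙 (r σ) + count r L)     ∎
  where open ≡-Reasoning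

count-insertions-perm : ∀ k {σ} → σ ↭ idPerm (suc k) →
  (count classI (insertions (2 + k) σ) ≡ 𝟙 (classI σ) + 0 * 𝟙 (classI σ))
  × (count classP (insertions (2 + k) σ) ≡ 𝟙 (classI σ) + 2 * 𝟙 (classP σ))
  × (count classN (insertions (2 + k) σ) ≡ 𝟙 (classP σ) + 1 * 𝟙 (classN σ))
count-insertions-perm k {[]}     σ↭ with () ← ↭-length σ↭
count-insertions-perm k {y ∷ ys} σ↭ with All-resp-↭ (↭-sym σ↭) (idPerm-< (suc k)) | Unique-↭-idPerm (suc k) σ↭
... | y<N ∷ ys<N | y∉ys ∷ _ =
  trans (count-insertions-I N y ys y<N ys<N ys≢y) (sym (+-identityʳ _)) ,
  count-insertions-P N y ys y<N ys<N ys≢y ,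
  trans (count-insertions-N N y ys y<N ys<N ys≢y) (cong (𝟙 (classP (y ∷ ys)) +_) (sym (+-identityʳ _)))
  where
  N = 2 + k
  ys≢y : All (_≢ y) ys
  ys≢y = All.map ≢-sym y∉ys

count-I : ∀ k → count classI (perms (suc k)) ≡ 1
count-I zero    = refl
count-I (suc k) =
  trans (count-concatMap-linear classI (insertions (2 + k)) classI classI 0 (perms (suc k))
          (All.map (λ σ↭ → proj₁ (count-insertions-perm k σ↭)) (perms-↭ (suc k))))
        (trans (+-identityʳ _) (count-I k))

count-P-N : ∀ k → (count classP (perms (suc k)) + 1 ≡ 2 ^ k) × (count classN (perms (suc k)) + suc k ≡ 2 ^ k)
count-P-N zero    = refl , refl
count-P-N (suc k) = P-step , N-step
  where
  open +-*-Solver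
  P = count classP (perms (suc k))
  C = count classN (perms (suc k))
  hP : P + 1 ≡ 2 ^ k
  hP = proj₁ (count-P-N k)
  hN : C + suc k ≡ 2 ^ k
  hN = proj₂ (count-P-N k)
  P-step : count classP (perms (2 + k)) + 1 ≡ 2 ^ suc k
  P-step rewrite count-concatMap-linear classP (insertions (2 + k)) classI classP 2 (perms (suc k))
                   (All.map (λ σ↭ → proj₁ (proj₂ (count-insertions-perm k σ↭))) (perms-↭ (suc k)))
               | count-I k =
    trans (solve 1 (λ p → (con 1 :+ con 2 :* p) :+ con 1 := con 2 :* (p :+ con 1)) refl P) (cong (2 *_) hP)
  N-step : count classN (perms (2 + k)) + suc (suc k) ≡ 2 ^ suc k
  N-step rewrite count-concatMap-linear classN (insertions (2 + k)) classP classN 1 (perms (suc k))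
                   (All.map (λ σ↭ → proj₂ (proj₂ (count-insertions-perm k σ↭))) (perms-↭ (suc k))) =
    trans (solve 3 (λ p c n → (p :+ con 1 :* c) :+ (con 2 :+ n) := (p :+ con 1) :+ ((c :+ (con 1 :+ n)) :+ con 0))
                 refl P C k)
          (cong₂ (λ a b → a + (b + 0)) hP hN)

count-partition : {X : Set} (p q r s : X → Bool) (xs : List X) →
  All (λ x → 𝟙 (p x) ≡ 𝟙 (q x) + 𝟙 (r x) + 𝟙 (s x)) xs → count p xs ≡ count q xs + count r xs + count s xs
count-partition p q r s []       []          = refl
count-partition p q r s (x ∷ xs) (eqx ∷ eqs) rewrite eqx | count-partition p q r s xs eqs =
  solve 6 (λ a b c d e f → (a :+ b :+ c) :+ (d :+ e :+ f) := (a :+ d) :+ (b :+ e) :+ (c :+ f)) refl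
    (𝟙 (q x)) (𝟙 (r x)) (𝟙 (s x)) (count q xs) (count r xs) (count s xs)
  where open +-*-Solver

count-accepted : ∀ k → count (accepts empty) (perms (suc k)) ≡ 2 ^ suc k ∸ suc k
count-accepted k = begin
  count (accepts empty) (perms (suc k))                  ≡⟨ sym (m+n∸n≡m _ (suc k)) ⟩
  count (accepts empty) (perms (suc k)) + suc k ∸ suc k  ≡⟨ cong (_∸ suc k) total ⟩
  2 ^ suc k ∸ suc k                                      ∎
  where
  open ≡-Reasoning
  open +-*-Solver
  P = count classP (perms (suc k))
  C = count classN (perms (suc k))
  total : count (accepts empty) (perms (suc k)) + suc k ≡ 2 ^ suc k
  total rewrite count-partition (accepts empty) classI classP classN (perms (suc k))
                  (All.universal accepts-classes (perms (suc k)))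
              | count-I k =
    trans (solve 3 (λ p c n → (con 1 :+ p :+ c) :+ (con 1 :+ n) := (p :+ con 1) :+ ((c :+ (con 1 :+ n)) :+ con 0))
                 refl P C k)
          (cong₂ (λ a b → a + (b + 0)) (proj₁ (count-P-N k)) (proj₂ (count-P-N k)))

length-filter : {X : Set} {P : X → Set} (P? : ∀ x → Dec (P x)) (xs : List X) →
  length (filter P? xs) ≡ count (λ x → does (P? x)) xs
length-filter P? []       = refl
length-filter P? (x ∷ xs) with does (P? x)
... | true  = cong suc (length-filter P? xs)
... | false = length-filter P? xs

mainTheorem16 : (n : ℕ) → 1 ≤ n → length (Sort1-23 n) ≡ 2 ^ n ∸ n
mainTheorem16 (suc k) _ = begin
  length (Sort1-23 (suc k))
    ≡⟨ length-filter (λ τ → ≡-dec _≟_ (westSort (stackMap1-23 τ)) (idPerm (suc k))) (perms (suc k)) ⟩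
  count (λ τ → does (≡-dec _≟_ (westSort (stackMap1-23 τ)) (idPerm (suc k)))) (perms (suc k))
    ≡⟨ count-cong (perms (suc k)) (All.map (sortable⇔accepted (suc k) _) (perms-↭ (suc k))) ⟩
  count (accepts empty) (perms (suc k))
    ≡⟨ count-accepted k ⟩
  2 ^ suc k ∸ suc k ∎
  where open ≡-Reasoning
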